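{- Let $n,r,c$ be positive integers with $r\geq 8$ and $c>1$, and let $A\subseteq[n]$ with $|A|=\lceil n/2\rceil+c$. (i) If there is $t\in A$ with $k(t,A)\geq 2(c-1)$, then $g(A,r)<r^{\lceil n/2\rceil+1}$. (ii) If there is $t\in A$ with $k(t,A)\geq 2(c-1)+1$, then $g(A,r)<r^{\lceil n/2\rceil}(3-2/r)$.
   Context: A restricted Schur triple in $[n]$ is an ordered triple $(a,b,c)$ with $a<b<c$ and $a+b=c$. For $t\in A$, the link graph $L_t(A)$ is the simple graph on vertex set $A\setminus\{t\}$ in which $xy$ is an edge iff $t,x,y$ (in increasing order) form a restricted Schur triple with all entries in $A$; $k(t,A)$ is the size of a maximum matching of $L_t(A)$. An $r$-coloring of $A$ is a map $A\to[r]$; a rainbow sum is a triple of distinct $x,y,z$ with $x+y=z$ colored with three different colors; a coloring is rainbow sum-free if it has no rainbow sum. $g(A,r)$ is the number of rainbow sum-free $r$-colorings of $A$. -}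

module Defs where

open import Data.Nat using (ℕ; zero; suc; _+_; _*_; _≤_; _<_)
open import Data.Nat.Properties using (_≟_)
open import Data.Fin using (Fin)
open import Data.Fin.Properties using (any?) renaming (_≟_ to _≟ᶠ_)
open import Data.List using (List; []; _∷_; length; lookup; map; concatMap; filter; allFin)
open import Data.List.Membership.Propositional using (_∈_)
open import Data.List.Relation.Unary.Unique.Propositional using (Unique)
open import Data.List.Relation.Unary.All using (All)
open import Data.Vec using (Vec; []; _∷_) renaming (lookup to vlookup)
open import Data.Product using (Σ; _×_; _,_; ∃; ∃-syntax)
open import Data.Sum using (_⊎_)
open import Relation.Binary.PropositionalEquality using (_≡_; _≢_)
open import Relation.Nullary using (¬_; Dec; ¬?)
open import Relation.Nullary.Decidable using (_×-dec_)

SubsetOf : ℕ → List ℕ → Set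
SubsetOf n A = Unique A × All (λ x → 1 ≤ x × x ≤ n) A

card : List ℕ → ℕ
card = length

SchurTriple : ℕ → ℕ → ℕ → Set
SchurTriple a b c = a < b × b < c × a + b ≡ c

-- xy is an edge of the link graph L_t(A): x, y ∈ A ∖ {t}, x ≠ y, and
-- t, x, y in increasing order form a restricted Schur triple
-- (we list all six orderings; only the increasing one can hold).
LinkEdge : ℕ → List ℕ → ℕ → ℕ → Set
LinkEdge t A x y =
  x ∈ A × y ∈ A × x ≢ t × y ≢ t × x ≢ y ×
  (SchurTriple t x y ⊎ SchurTriple t y x ⊎ SchurTriple x t y ⊎
   SchurTriple y t x ⊎ SchurTriple x y t ⊎ SchurTriple y x t)

endpoints : List (ℕ × ℕ) → List ℕ
endpoints [] = []
endpoints ((x , y) ∷ es) = x ∷ y ∷ endpoints es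

IsMatching : ℕ → List ℕ → List (ℕ × ℕ) → Set
IsMatching t A M = All (λ e → LinkEdge t A (Data.Product.proj₁ e) (Data.Product.proj₂ e)) M
                   × Unique (endpoints M)

-- k(t,A) ≥ m  (the maximum matching size of L_t(A) is at least m)
-- iff L_t(A) has a matching with m edges.
kAtLeast : ℕ → List ℕ → ℕ → Set
kAtLeast t A m = ∃[ M ] (IsMatching t A M × length M ≡ m)

-- an r-colouring of A: colour of the i-th element of A is the i-th entry
Coloring : List ℕ → ℕ → Set
Coloring A r = Vec (Fin r) (length A)

RainbowSum : (A : List ℕ) (r : ℕ) → Coloring A r → Set
RainbowSum A r χ =
  ∃[ i ] ∃[ j ] ∃[ k ]
    (lookup A i ≢ lookup A j × lookup A i ≢ lookup A k × lookup A j ≢ lookup A k ×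
     lookup A i + lookup A j ≡ lookup A k ×
     vlookup χ i ≢ vlookup χ j × vlookup χ i ≢ vlookup χ k × vlookup χ j ≢ vlookup χ k)

RainbowSumFree : (A : List ℕ) (r : ℕ) → Coloring A r → Set
RainbowSumFree A r χ = ¬ RainbowSum A r χ

rainbowSum? : (A : List ℕ) (r : ℕ) (χ : Coloring A r) → Dec (RainbowSum A r χ)
rainbowSum? A r χ =
  any? λ i → any? λ j → any? λ k →
    ¬? (lookup A i ≟ lookup A j) ×-dec ¬? (lookup A i ≟ lookup A k) ×-dec
    ¬? (lookup A j ≟ lookup A k) ×-dec (lookup A i + lookup A j ≟ lookup A k) ×-dec
    ¬? (vlookup χ i ≟ᶠ vlookup χ j) ×-dec ¬? (vlookup χ i ≟ᶠ vlookup χ k) ×-dec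
    ¬? (vlookup χ j ≟ᶠ vlookup χ k)

-- list of all vectors of length m over Fin r (each exactly once)
allVecs : (m r : ℕ) → List (Vec (Fin r) m)
allVecs zero r = [] ∷ []
allVecs (suc m) r = concatMap (λ c → map (c ∷_) (allVecs m r)) (allFin r)

g : List ℕ → ℕ → ℕ
g A r = length (filter (λ χ → ¬? (rainbowSum? A r χ)) (allVecs (length A) r))

-- Fix t ∈ A and a matching (a₁,b₁),…,(a_k,b_k) of L_t(A). If a colouring is rainbow-sum-free
-- and t has colour c, then each triple {t, aᵢ, bᵢ} is a Schur triple, so the colour pair of
-- (aᵢ, bᵢ) lies in {(x, y) : x = y ∨ x = c ∨ y = c}, a set of at most 3r − 2 of the r² pairs.
-- Since t and the aᵢ, bᵢ are distinct positions these constraints are independent, whence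
-- g(A, r) ≤ r · (3r − 2)ᵏ · r^(|A| − 1 − 2k). For |A| = ⌈n/2⌉ + c and k = 2(c − 1) (resp. one
-- more), both bounds follow from (3r − 2)² < r³, which holds for r ≥ 8.

module Submission where

open import Defs
open import Data.Nat using (ℕ; _+_; _*_; _∸_; _^_; _≤_; _<_; ⌈_/2⌉)
open import Data.List using (List)
open import Data.Product using (_×_; ∃-syntax)
open import Relation.Binary.PropositionalEquality using (_≡_)
open import Data.List.Membership.Propositional using (_∈_)

open import Data.Bool using (Bool; true; false; _∨_)
open import Data.Empty using (⊥-elim)
open import Data.Fin using (Fin; zero; suc)
open import Data.Fin.Properties using (_≟_)
import Data.List as List
open import Data.List using ([]; _∷_; length; map; filter; concatMap; tabulate; allFin)
open import Data.List.Properties using (map-concatMap; map-∘)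
open import Data.List.Relation.Unary.All as All using (All; []; _∷_)
open import Data.List.Relation.Unary.AllPairs using ([]; _∷_)
open import Data.List.Relation.Unary.Any using (index)
open import Data.List.Relation.Unary.Any.Properties using (lookup-index)
open import Data.List.Relation.Unary.Unique.Propositional using (Unique)
import Data.List.Relation.Unary.Unique.Propositional.Properties as Unique
open import Data.Nat using (zero; suc; z≤n; s≤s; NonZero)
open import Data.Nat.ListAction using () renaming (sum to sumˡ)
open import Data.Nat.ListAction.Properties using (sum-++)
open import Data.Nat.Properties hiding (_≟_)
open import Algebra.Properties.CommutativeSemigroup *-commutativeSemigroup
  using (x∙yz≈y∙xz; x∙yz≈yx∙z; xy∙z≈y∙xz)
open import Algebra.Properties.Semiring.Sum +-*-semiring
  using (sum; sum-syntax; sum-cong-≗; ∑-comm; ∑-distrib-+; *-distribˡ-sum; *-distribʳ-sum)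
open import Data.Nat.Tactic.RingSolver using (solve-∀)
open import Data.Product using (_,_; proj₁; proj₂)
open import Data.Sum using (_⊎_; inj₁; inj₂)
open import Data.Vec using (Vec; []; _∷_; lookup; insertAt; _[_]≔_)
open import Data.Vec.Properties using (insertAt-lookup; lookup∘update′)
open import Function using (_∘_)
open import Relation.Binary.PropositionalEquality
  using (refl; sym; trans; cong; cong₂; subst; subst₂; _≗_; _≢_; ≢-sym; module ≡-Reasoning)
open import Relation.Nullary using (does; yes; no; ¬?)
open import Relation.Nullary.Decidable using (dec-true)
open import Relation.Unary using (Decidable)

indicator : Bool → ℕ
indicator true  = 1
indicator false = 0

indicator≤1 : ∀ b → indicator b ≤ 1
indicator≤1 true  = ≤-refl
indicator≤1 false = z≤n

indicator-∨ : ∀ a b → indicator (a ∨ b) ≤ indicator a + indicator b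
indicator-∨ true  b = s≤s z≤n
indicator-∨ false b = ≤-refl

∑-const : ∀ n a → ∑[ i < n ] a ≡ n * a
∑-const zero    a = refl
∑-const (suc n) a = cong (a +_) (∑-const n a)

∑-mono-≤ : ∀ {n} {f g : Fin n → ℕ} → (∀ i → f i ≤ g i) → sum f ≤ sum g
∑-mono-≤ {zero}  f≤g = z≤n
∑-mono-≤ {suc n} f≤g = +-mono-≤ (f≤g zero) (∑-mono-≤ (f≤g ∘ suc))

term≤∑ : ∀ {n} (f : Fin n → ℕ) i → f i ≤ sum f
term≤∑ f zero    = m≤m+n _ _
term≤∑ f (suc i) = ≤-trans (term≤∑ (f ∘ suc) i) (m≤n+m _ _)

length-filter≤sum : ∀ {a p} {A : Set a} {P : A → Set p} (P? : Decidable P) (f : A → ℕ) →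
                    (∀ x → P x → 1 ≤ f x) → ∀ xs → length (filter P? xs) ≤ sumˡ (map f xs)
length-filter≤sum P? f P⇒1≤f []       = z≤n
length-filter≤sum P? f P⇒1≤f (x ∷ xs) with P? x
... | yes Px = +-mono-≤ (P⇒1≤f x Px) (length-filter≤sum P? f P⇒1≤f xs)
... | no  _  = ≤-trans (length-filter≤sum P? f P⇒1≤f xs) (m≤n+m _ (f x))

sum-concatMap : ∀ {a} {A : Set a} (g : A → List ℕ) xs → sumˡ (concatMap g xs) ≡ sumˡ (map (sumˡ ∘ g) xs)
sum-concatMap g []       = refl
sum-concatMap g (x ∷ xs) = trans (sum-++ (g x) _) (cong (sumˡ (g x) +_) (sum-concatMap g xs))

sum-map-tabulate : ∀ {a} {A : Set a} {n} (f : A → ℕ) (g : Fin n → A) →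
                   sumˡ (map f (tabulate g)) ≡ ∑[ i < n ] f (g i)
sum-map-tabulate {n = zero}  f g = refl
sum-map-tabulate {n = suc n} f g = cong (f (g zero) +_) (sum-map-tabulate f (g ∘ suc))

insertAt-[]≔ : ∀ {a} {A : Set a} {m} (w : Vec A m) i x y → insertAt w i x [ i ]≔ y ≡ insertAt w i y
insertAt-[]≔ w       zero    x y = refl
insertAt-[]≔ (z ∷ w) (suc i) x y = cong (z ∷_) (insertAt-[]≔ w i x y)

positions : ∀ {a} {A : Set a} → List (A × A) → List A
positions []             = []
positions ((x , y) ∷ ps) = x ∷ y ∷ positions ps

module _ {r : ℕ} where

  size : (Fin r → Bool) → ℕ
  size S = ∑[ x < r ] indicator (S x)

  size₂ : (Fin r → Fin r → Bool) → ℕ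
  size₂ R = ∑[ x < r ] size (R x)

  ∑ᵛ : ∀ m → (Vec (Fin r) m → ℕ) → ℕ
  ∑ᵛ zero    f = f []
  ∑ᵛ (suc m) f = ∑[ x < r ] ∑ᵛ m (λ v → f (x ∷ v))

  ∑ᵛ-cong : ∀ m {f g : Vec (Fin r) m → ℕ} → f ≗ g → ∑ᵛ m f ≡ ∑ᵛ m g
  ∑ᵛ-cong zero    f≗g = f≗g []
  ∑ᵛ-cong (suc m) f≗g = sum-cong-≗ λ x → ∑ᵛ-cong m (f≗g ∘ (x ∷_))

  ∑ᵛ-*ˡ : ∀ m a (f : Vec (Fin r) m → ℕ) → ∑ᵛ m (λ v → a * f v) ≡ a * ∑ᵛ m f
  ∑ᵛ-*ˡ zero    a f = refl
  ∑ᵛ-*ˡ (suc m) a f = trans (sum-cong-≗ λ x → ∑ᵛ-*ˡ m a (f ∘ (x ∷_))) (sym (*-distribˡ-sum {r} a _))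

  ∑ᵛ-const : ∀ m a → ∑ᵛ m (λ _ → a) ≡ r ^ m * a
  ∑ᵛ-const zero    a = sym (*-identityˡ a)
  ∑ᵛ-const (suc m) a = begin
    ∑[ x < r ] ∑ᵛ m (λ _ → a) ≡⟨ sum-cong-≗ {r} (λ _ → ∑ᵛ-const m a) ⟩
    ∑[ x < r ] (r ^ m * a)    ≡⟨ ∑-const r _ ⟩
    r * (r ^ m * a)           ≡⟨ *-assoc r _ a ⟨
    r ^ suc m * a             ∎
    where open ≡-Reasoning

  ∑ᵛ-∑-comm : ∀ m {n} (f : Fin n → Vec (Fin r) m → ℕ) →
              ∑ᵛ m (λ v → ∑[ c < n ] f c v) ≡ ∑[ c < n ] ∑ᵛ m (f c)
  ∑ᵛ-∑-comm zero    f = refl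
  ∑ᵛ-∑-comm (suc m) {n} f =
    trans (sum-cong-≗ λ x → ∑ᵛ-∑-comm m (λ c → f c ∘ (x ∷_))) (∑-comm {r} {n} _)

  ∑ᵛ-insertAt : ∀ m (i : Fin (suc m)) (f : Vec (Fin r) (suc m) → ℕ) →
                ∑ᵛ (suc m) f ≡ ∑[ x < r ] ∑ᵛ m (λ w → f (insertAt w i x))
  ∑ᵛ-insertAt m       zero    f = refl
  ∑ᵛ-insertAt (suc m) (suc i) f =
    trans (sum-cong-≗ λ y → ∑ᵛ-insertAt m i (f ∘ (y ∷_))) (∑-comm {r} {r} _)

  Independent : ∀ {m} → Fin m → (Vec (Fin r) m → ℕ) → Set
  Independent i f = ∀ v x → f (v [ i ]≔ x) ≡ f v

  independent-* : ∀ {m} {i : Fin m} {f g} → Independent i f → Independent i g →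
                  Independent i (λ v → f v * g v)
  independent-* f-ind g-ind v x = cong₂ _*_ (f-ind v x) (g-ind v x)

  independent-lookup : ∀ {m} {i j : Fin m} → j ≢ i → (h : Fin r → ℕ) →
                       Independent i (λ v → h (lookup v j))
  independent-lookup j≢i h v x = cong h (lookup∘update′ j≢i v x)

  -- The vectors with i-th coordinate x are exactly the insertAt w i x; since h x ignores
  -- coordinate i, its sum over them does not depend on x.
  ∑ᵛ-lookup : ∀ {m} (i : Fin m) (h : Fin r → Vec (Fin r) m → ℕ) → (∀ x → Independent i (h x)) →
              r * ∑ᵛ m (λ v → h (lookup v i) v) ≡ ∑[ x < r ] ∑ᵛ m (h x)
  ∑ᵛ-lookup {suc m} i h h-ind = begin
    r * ∑ᵛ (suc m) (λ v → h (lookup v i) v)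
      ≡⟨ cong (r *_) (∑ᵛ-insertAt m i (λ v → h (lookup v i) v)) ⟩
    r * (∑[ x < r ] ∑ᵛ m (λ w → h (lookup (insertAt w i x) i) (insertAt w i x)))
      ≡⟨ cong (r *_) (sum-cong-≗ {r} λ x → ∑ᵛ-cong m λ w →
                       cong (λ y → h y (insertAt w i x)) (insertAt-lookup w i x)) ⟩
    r * (∑[ x < r ] ∑ᵛ m (λ w → h x (insertAt w i x)))
      ≡⟨ ∑-const r _ ⟨
    ∑[ y < r ] ∑[ x < r ] ∑ᵛ m (λ w → h x (insertAt w i x))
      ≡⟨ ∑-comm {r} {r} _ ⟩
    ∑[ x < r ] ∑[ y < r ] ∑ᵛ m (λ w → h x (insertAt w i x))
      ≡⟨ sum-cong-≗ {r} (λ x → sum-cong-≗ {r} λ y → ∑ᵛ-cong m λ w → moved x y w) ⟩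
    ∑[ x < r ] ∑[ y < r ] ∑ᵛ m (λ w → h x (insertAt w i y))
      ≡⟨ sum-cong-≗ {r} (λ x → ∑ᵛ-insertAt m i (h x)) ⟨
    ∑[ x < r ] ∑ᵛ (suc m) (h x) ∎
    where
    open ≡-Reasoning
    moved : ∀ x y w → h x (insertAt w i x) ≡ h x (insertAt w i y)
    moved x y w = trans (cong (h x) (sym (insertAt-[]≔ w i y x))) (h-ind x (insertAt w i y) x)

  ∑ᵛ-factor : ∀ {m} (i : Fin m) (S : Fin r → Bool) (f : Vec (Fin r) m → ℕ) → Independent i f →
              r * ∑ᵛ m (λ v → indicator (S (lookup v i)) * f v) ≡ size S * ∑ᵛ m f
  ∑ᵛ-factor {m} i S f f-ind = begin
    r * ∑ᵛ m (λ v → indicator (S (lookup v i)) * f v)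
      ≡⟨ ∑ᵛ-lookup i (λ x v → indicator (S x) * f v) (λ x v y → cong (indicator (S x) *_) (f-ind v y)) ⟩
    ∑[ x < r ] ∑ᵛ m (λ v → indicator (S x) * f v)
      ≡⟨ sum-cong-≗ {r} (λ x → ∑ᵛ-*ˡ m (indicator (S x)) f) ⟩
    ∑[ x < r ] (indicator (S x) * ∑ᵛ m f)
      ≡⟨ *-distribʳ-sum {r} (∑ᵛ m f) _ ⟨
    size S * ∑ᵛ m f ∎
    where open ≡-Reasoning

  ∑ᵛ-factor₂ : ∀ {m} {i j : Fin m} → i ≢ j → (R : Fin r → Fin r → Bool) (f : Vec (Fin r) m → ℕ) →
               Independent i f → Independent j f →
               r * (r * ∑ᵛ m (λ v → indicator (R (lookup v i) (lookup v j)) * f v)) ≡ size₂ R * ∑ᵛ m f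
  ∑ᵛ-factor₂ {m} {i} {j} i≢j R f i-ind j-ind = begin
    r * (r * ∑ᵛ m (λ v → indicator (R (lookup v i) (lookup v j)) * f v))
      ≡⟨ cong (r *_) (∑ᵛ-lookup i (λ x v → indicator (R x (lookup v j)) * f v)
                       (λ x → independent-* (independent-lookup (≢-sym i≢j) (indicator ∘ R x)) i-ind)) ⟩
    r * (∑[ x < r ] ∑ᵛ m (λ v → indicator (R x (lookup v j)) * f v))
      ≡⟨ *-distribˡ-sum {r} r _ ⟩
    ∑[ x < r ] (r * ∑ᵛ m (λ v → indicator (R x (lookup v j)) * f v))
      ≡⟨ sum-cong-≗ {r} (λ x → ∑ᵛ-factor j (R x) f j-ind) ⟩
    ∑[ x < r ] (size (R x) * ∑ᵛ m f)
      ≡⟨ *-distribʳ-sum {r} (∑ᵛ m f) _ ⟨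
    size₂ R * ∑ᵛ m f ∎
    where open ≡-Reasoning

  size-≟ : (c : Fin r) → size (λ y → does (y ≟ c)) ≡ 1
  size-≟ c = go c
    where
    go : ∀ {n} (c : Fin n) → ∑[ y < n ] indicator (does (y ≟ c)) ≡ 1
    go {suc n} zero    = cong suc (trans (∑-const n 0) (*-zeroʳ n))
    go         (suc c) = go c

  pairsHold : ∀ {m} → (Fin r → Fin r → Bool) → List (Fin m × Fin m) → Vec (Fin r) m → ℕ
  pairsHold R []             v = 1
  pairsHold R ((a , b) ∷ ps) v = indicator (R (lookup v a) (lookup v b)) * pairsHold R ps v

  pairsHold-independent : ∀ {m} {i : Fin m} R ps → All (i ≢_) (positions ps) →
                          Independent i (pairsHold R ps)
  pairsHold-independent R []             []                      v x = refl
  pairsHold-independent R ((a , b) ∷ ps) (i≢a ∷ i≢b ∷ i∉ps) v x =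
    cong₂ _*_ (cong₂ (λ y z → indicator (R y z)) (lookup∘update′ (≢-sym i≢a) v x)
                                                 (lookup∘update′ (≢-sym i≢b) v x))
              (pairsHold-independent R ps i∉ps v x)

  ∑ᵛ-pairsHold : ∀ {m} R ps (h : Vec (Fin r) m → ℕ) → Unique (positions ps) →
                 All (λ i → Independent i h) (positions ps) →
                 r ^ (2 * length ps) * ∑ᵛ m (λ v → pairsHold R ps v * h v) ≡ size₂ R ^ length ps * ∑ᵛ m h
  ∑ᵛ-pairsHold {m} R [] h _ _ = cong (1 *_) (∑ᵛ-cong m λ v → *-identityˡ (h v))
  ∑ᵛ-pairsHold {m} R ((a , b) ∷ ps) h ((a≢b ∷ a∉ps) ∷ (b∉ps ∷ unique)) (a-ind ∷ b-ind ∷ ps-ind) = begin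
    r ^ (2 * suc k) * ∑ᵛ m (λ v → (indicator (R (lookup v a) (lookup v b)) * pairsHold R ps v) * h v)
      ≡⟨ cong₂ _*_ (cong (r ^_) (*-suc 2 k))
                   (∑ᵛ-cong m λ v → *-assoc (indicator (R (lookup v a) (lookup v b))) (pairsHold R ps v) (h v)) ⟩
    r * (r * r ^ (2 * k)) * ∑ᵛ m (λ v → indicator (R (lookup v a) (lookup v b)) * F v)
      ≡⟨ shuffle r (r ^ (2 * k)) _ ⟩
    r ^ (2 * k) * (r * (r * ∑ᵛ m (λ v → indicator (R (lookup v a) (lookup v b)) * F v)))
      ≡⟨ cong (r ^ (2 * k) *_) (∑ᵛ-factor₂ a≢b R F (F-ind a∉ps a-ind) (F-ind b∉ps b-ind)) ⟩
    r ^ (2 * k) * (size₂ R * ∑ᵛ m F)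
      ≡⟨ x∙yz≈y∙xz (r ^ (2 * k)) (size₂ R) _ ⟩
    size₂ R * (r ^ (2 * k) * ∑ᵛ m F)
      ≡⟨ cong (size₂ R *_) (∑ᵛ-pairsHold R ps h unique ps-ind) ⟩
    size₂ R * (size₂ R ^ k * ∑ᵛ m h)
      ≡⟨ *-assoc (size₂ R) _ _ ⟨
    size₂ R ^ suc k * ∑ᵛ m h ∎
    where
    open ≡-Reasoning
    k = length ps
    F : Vec (Fin r) m → ℕ
    F v = pairsHold R ps v * h v
    F-ind : ∀ {i} → All (i ≢_) (positions ps) → Independent i h → Independent i F
    F-ind i∉ps h-ind = independent-* (pairsHold-independent R ps i∉ps) h-ind
    shuffle : ∀ r p s → r * (r * p) * s ≡ p * (r * (r * s))
    shuffle = solve-∀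

  ∑ᵛ-pairsHold-colourAt : ∀ {m} (i : Fin m) (c : Fin r) R ps → Unique (i ∷ positions ps) →
                   r ^ (1 + 2 * length ps) * ∑ᵛ m (λ v → pairsHold R ps v * indicator (does (lookup v i ≟ c)))
                     ≡ size₂ R ^ length ps * r ^ m
  ∑ᵛ-pairsHold-colourAt {m} i c R ps (i∉ps ∷ unique) = begin
    r * r ^ (2 * k) * ∑ᵛ m (λ v → pairsHold R ps v * h v)
      ≡⟨ *-assoc r _ _ ⟩
    r * (r ^ (2 * k) * ∑ᵛ m (λ v → pairsHold R ps v * h v))
      ≡⟨ cong (r *_) (∑ᵛ-pairsHold R ps h unique
                       (All.map (λ i≢p → independent-lookup i≢p (λ x → indicator (does (x ≟ c)))) i∉ps)) ⟩
    r * (size₂ R ^ k * ∑ᵛ m h)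
      ≡⟨ x∙yz≈y∙xz r (size₂ R ^ k) (∑ᵛ m h) ⟩
    size₂ R ^ k * (r * ∑ᵛ m h)
      ≡⟨ cong (size₂ R ^ k *_) r*∑h ⟩
    size₂ R ^ k * r ^ m ∎
    where
    open ≡-Reasoning
    k = length ps
    h : Vec (Fin r) m → ℕ
    h v = indicator (does (lookup v i ≟ c))
    r*∑h : r * ∑ᵛ m h ≡ r ^ m
    r*∑h = begin
      r * ∑ᵛ m h
        ≡⟨ ∑ᵛ-lookup i (λ x _ → indicator (does (x ≟ c))) (λ _ _ _ → refl) ⟩
      ∑[ x < r ] ∑ᵛ m (λ _ → indicator (does (x ≟ c)))
        ≡⟨ sum-cong-≗ {r} (λ x → ∑ᵛ-const m _) ⟩
      ∑[ x < r ] (r ^ m * indicator (does (x ≟ c)))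
        ≡⟨ *-distribˡ-sum {r} (r ^ m) (λ x → indicator (does (x ≟ c))) ⟨
      r ^ m * size (λ x → does (x ≟ c))
        ≡⟨ cong (r ^ m *_) (size-≟ c) ⟩
      r ^ m * 1
        ≡⟨ *-identityʳ (r ^ m) ⟩
      r ^ m ∎

  sum-map-allVecs : ∀ m (f : Vec (Fin r) m → ℕ) → sumˡ (map f (allVecs m r)) ≡ ∑ᵛ m f
  sum-map-allVecs zero    f = +-identityʳ (f [])
  sum-map-allVecs (suc m) f = begin
    sumˡ (map f (concatMap (λ x → map (x ∷_) (allVecs m r)) (allFin r)))
      ≡⟨ cong sumˡ (map-concatMap f _ (allFin r)) ⟩
    sumˡ (concatMap (λ x → map f (map (x ∷_) (allVecs m r))) (allFin r))
      ≡⟨ sum-concatMap _ (allFin r) ⟩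
    sumˡ (map (λ x → sumˡ (map f (map (x ∷_) (allVecs m r)))) (allFin r))
      ≡⟨ sum-map-tabulate {n = r} (λ x → sumˡ (map f (map (x ∷_) (allVecs m r)))) (λ x → x) ⟩
    ∑[ x < r ] sumˡ (map f (map (x ∷_) (allVecs m r)))
      ≡⟨ sum-cong-≗ {r} (λ x → trans (cong sumˡ (sym (map-∘ (allVecs m r)))) (sum-map-allVecs m (f ∘ (x ∷_)))) ⟩
    ∑[ x < r ] ∑ᵛ m (λ v → f (x ∷ v)) ∎
    where open ≡-Reasoning

  g≤∑ᵛ : ∀ A (f : Coloring A r → ℕ) → (∀ χ → RainbowSumFree A r χ → 1 ≤ f χ) →
         g A r ≤ ∑ᵛ (length A) f
  g≤∑ᵛ A f free⇒1≤f =
    ≤-trans (length-filter≤sum (λ χ → ¬? (rainbowSum? A r χ)) f free⇒1≤f (allVecs (length A) r))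
            (≤-reflexive (sum-map-allVecs (length A) f))

  allowed : Fin r → Fin r → Fin r → Bool
  allowed c x y = does (y ≟ x) ∨ does (x ≟ c) ∨ does (y ≟ c)

  size-allowed : ∀ c x → size (allowed c x) ≤ 2 + (r ∸ 2) * indicator (does (x ≟ c))
  size-allowed c x with x ≟ c
  ... | yes _ = begin
    size (λ y → does (y ≟ x) ∨ true ∨ does (y ≟ c))
                                ≤⟨ ∑-mono-≤ {r} (λ y → indicator≤1 _) ⟩
    ∑[ y < r ] 1                ≡⟨ ∑-const r 1 ⟩
    r * 1                       ≡⟨ *-identityʳ r ⟩
    r                           ≤⟨ m≤n+m∸n r 2 ⟩
    2 + (r ∸ 2)                 ≡⟨ cong (2 +_) (*-identityʳ (r ∸ 2)) ⟨
    2 + (r ∸ 2) * 1             ∎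
    where open ≤-Reasoning
  ... | no _ = begin
    size (λ y → does (y ≟ x) ∨ does (y ≟ c))
      ≤⟨ ∑-mono-≤ (λ y → indicator-∨ (does (y ≟ x)) (does (y ≟ c))) ⟩
    ∑[ y < r ] (indicator (does (y ≟ x)) + indicator (does (y ≟ c)))
      ≡⟨ ∑-distrib-+ {r} _ _ ⟩
    size (λ y → does (y ≟ x)) + size (λ y → does (y ≟ c))
      ≡⟨ cong₂ _+_ (size-≟ x) (size-≟ c) ⟩
    2
      ≡⟨ cong (2 +_) (*-zeroʳ (r ∸ 2)) ⟨
    2 + (r ∸ 2) * 0 ∎
    where open ≤-Reasoning

  size₂-allowed : 2 ≤ r → ∀ c → size₂ (allowed c) ≤ 3 * r ∸ 2
  size₂-allowed 2≤r c = begin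
    size₂ (allowed c)
      ≤⟨ ∑-mono-≤ (size-allowed c) ⟩
    ∑[ x < r ] (2 + (r ∸ 2) * indicator (does (x ≟ c)))
      ≡⟨ ∑-distrib-+ {r} _ _ ⟩
    ∑[ x < r ] 2 + ∑[ x < r ] ((r ∸ 2) * indicator (does (x ≟ c)))
      ≡⟨ cong₂ _+_ (∑-const r 2) (sym (*-distribˡ-sum {r} (r ∸ 2) _)) ⟩
    r * 2 + (r ∸ 2) * size (λ x → does (x ≟ c))
      ≡⟨ cong (λ s → r * 2 + (r ∸ 2) * s) (size-≟ c) ⟩
    r * 2 + (r ∸ 2) * 1
      ≡⟨ subst (λ r → r * 2 + (r ∸ 2) * 1 ≡ 3 * r ∸ 2) (m+[n∸m]≡n 2≤r) (count (r ∸ 2)) ⟩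
    3 * r ∸ 2 ∎
    where
    open ≤-Reasoning
    -- 3 * (2 + s) ∸ 2 reduces to the ∸-free right-hand side of ring.
    count : ∀ s → (2 + s) * 2 + (2 + s ∸ 2) * 1 ≡ 3 * (2 + s) ∸ 2
    count = ring
      where
      ring : ∀ s → (2 + s) * 2 + s * 1 ≡ s + ((2 + s) + ((2 + s) + 0))
      ring = solve-∀

SchurInSomeOrder : ℕ → ℕ → ℕ → Set
SchurInSomeOrder t x y =
  SchurTriple t x y ⊎ SchurTriple t y x ⊎ SchurTriple x t y ⊎
  SchurTriple y t x ⊎ SchurTriple x y t ⊎ SchurTriple y x t

module _ {r : ℕ} (A : List ℕ) where

  allowed-if-rainbowSumFree : (χ : Coloring A r) → RainbowSumFree A r χ → ∀ {i j k} {t x y} →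
    t ≡ List.lookup A i → x ≡ List.lookup A j → y ≡ List.lookup A k →
    x ≢ t → y ≢ t → x ≢ y → SchurInSomeOrder t x y →
    allowed (lookup χ i) (lookup χ j) (lookup χ k) ≡ true
  allowed-if-rainbowSumFree χ free {i} {j} {k} refl refl refl j≢i k≢i j≢k schur
    with lookup χ k ≟ lookup χ j | lookup χ j ≟ lookup χ i | lookup χ k ≟ lookup χ i
  ... | yes _ | _     | _     = refl
  ... | no _  | yes _ | _     = refl
  ... | no _  | no _  | yes _ = refl
  ... | no χk≢χj | no χj≢χi | no χk≢χi = ⊥-elim (free (rainbow schur))
    where
    rainbow : SchurInSomeOrder (List.lookup A i) (List.lookup A j) (List.lookup A k) → RainbowSum A r χ
    rainbow (inj₁ (_ , _ , sum)) =
      i , j , k , ≢-sym j≢i , ≢-sym k≢i , j≢k , sum , ≢-sym χj≢χi , ≢-sym χk≢χi , ≢-sym χk≢χj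
    rainbow (inj₂ (inj₁ (_ , _ , sum))) =
      i , k , j , ≢-sym k≢i , ≢-sym j≢i , ≢-sym j≢k , sum , ≢-sym χk≢χi , ≢-sym χj≢χi , χk≢χj
    rainbow (inj₂ (inj₂ (inj₁ (_ , _ , sum)))) =
      j , i , k , j≢i , j≢k , ≢-sym k≢i , sum , χj≢χi , ≢-sym χk≢χj , ≢-sym χk≢χi
    rainbow (inj₂ (inj₂ (inj₂ (inj₁ (_ , _ , sum))))) =
      k , i , j , k≢i , ≢-sym j≢k , ≢-sym j≢i , sum , χk≢χi , χk≢χj , ≢-sym χj≢χi
    rainbow (inj₂ (inj₂ (inj₂ (inj₂ (inj₁ (_ , _ , sum)))))) =
      j , k , i , j≢k , j≢i , k≢i , sum , ≢-sym χk≢χj , χj≢χi , χk≢χi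
    rainbow (inj₂ (inj₂ (inj₂ (inj₂ (inj₂ (_ , _ , sum)))))) =
      k , j , i , ≢-sym j≢k , k≢i , j≢i , sum , χk≢χj , χk≢χi , χj≢χi

  module _ {t : ℕ} (t∈A : t ∈ A) where

    tᵢ : Fin (length A)
    tᵢ = index t∈A

    LinkEdges : List (ℕ × ℕ) → Set
    LinkEdges M = All (λ e → LinkEdge t A (proj₁ e) (proj₂ e)) M

    edgePositions : ∀ M → LinkEdges M → List (Fin (length A) × Fin (length A))
    edgePositions []      []                        = []
    edgePositions (_ ∷ M) ((x∈A , y∈A , _) ∷ edges) = (index x∈A , index y∈A) ∷ edgePositions M edges

    length-edgePositions : ∀ M edges → length (edgePositions M edges) ≡ length M
    length-edgePositions []      []          = refl
    length-edgePositions (_ ∷ M) (_ ∷ edges) = cong suc (length-edgePositions M edges)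

    lookup-edgePositions : ∀ M edges → map (List.lookup A) (positions (edgePositions M edges)) ≡ endpoints M
    lookup-edgePositions []      []                        = refl
    lookup-edgePositions (_ ∷ M) ((x∈A , y∈A , _) ∷ edges) =
      cong₂ _∷_ (sym (lookup-index x∈A)) (cong₂ _∷_ (sym (lookup-index y∈A)) (lookup-edgePositions M edges))

    t∉endpoints : ∀ M → LinkEdges M → All (t ≢_) (endpoints M)
    t∉endpoints []      []                                 = []
    t∉endpoints (_ ∷ M) ((_ , _ , x≢t , y≢t , _) ∷ edges) = ≢-sym x≢t ∷ ≢-sym y≢t ∷ t∉endpoints M edges

    unique-edgePositions : ∀ M edges → Unique (endpoints M) → Unique (tᵢ ∷ positions (edgePositions M edges))
    unique-edgePositions M edges unique =
      Unique.map⁻ (subst Unique (cong₂ _∷_ (lookup-index t∈A) (sym (lookup-edgePositions M edges)))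
                                (t∉endpoints M edges ∷ unique))

    pairsHold-rainbowSumFree : (χ : Coloring A r) → RainbowSumFree A r χ → ∀ M edges →
                               pairsHold (allowed (lookup χ tᵢ)) (edgePositions M edges) χ ≡ 1
    pairsHold-rainbowSumFree χ free []      []    = refl
    pairsHold-rainbowSumFree χ free (_ ∷ M) ((x∈A , y∈A , x≢t , y≢t , x≢y , schur) ∷ edges) =
      cong₂ _*_ (cong indicator (allowed-if-rainbowSumFree χ free (lookup-index t∈A) (lookup-index x∈A)
                                                            (lookup-index y∈A) x≢t y≢t x≢y schur))
                (pairsHold-rainbowSumFree χ free M edges)

    g-matching-bound : 2 ≤ r → ∀ M (edges : LinkEdges M) → Unique (endpoints M) →
                       g A r * r ^ (1 + 2 * length M) ≤ r * ((3 * r ∸ 2) ^ length M * r ^ length A)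
    g-matching-bound 2≤r M edges unique = begin
      g A r * W
        ≤⟨ *-monoˡ-≤ W (g≤∑ᵛ A (λ χ → ∑[ c < r ] weight c χ) weight-at-colour-of-t) ⟩
      ∑ᵛ m (λ χ → ∑[ c < r ] weight c χ) * W
        ≡⟨ cong (_* W) (∑ᵛ-∑-comm m weight) ⟩
      (∑[ c < r ] ∑ᵛ m (weight c)) * W
        ≡⟨ *-distribʳ-sum {r} W (λ c → ∑ᵛ m (weight c)) ⟩
      ∑[ c < r ] (∑ᵛ m (weight c) * W)
        ≡⟨ sum-cong-≗ {r} (λ c → trans (*-comm _ W) (class-count c)) ⟩
      ∑[ c < r ] (size₂ (allowed c) ^ k * r ^ m)
        ≤⟨ ∑-mono-≤ {r} (λ c → *-monoˡ-≤ (r ^ m) (^-monoˡ-≤ k (size₂-allowed 2≤r c))) ⟩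
      ∑[ c < r ] ((3 * r ∸ 2) ^ k * r ^ m)
        ≡⟨ ∑-const r _ ⟩
      r * ((3 * r ∸ 2) ^ k * r ^ m) ∎
      where
      open ≤-Reasoning
      m = length A
      k = length M
      W = r ^ (1 + 2 * k)
      weight : Fin r → Coloring A r → ℕ
      weight c χ = pairsHold (allowed c) (edgePositions M edges) χ * indicator (does (lookup χ tᵢ ≟ c))
      weight-at-colour-of-t : ∀ χ → RainbowSumFree A r χ → 1 ≤ ∑[ c < r ] weight c χ
      weight-at-colour-of-t χ free = ≤-trans
        (≤-reflexive (sym (cong₂ _*_ (pairsHold-rainbowSumFree χ free M edges)
                                     (cong indicator (dec-true (lookup χ tᵢ ≟ lookup χ tᵢ) refl)))))
        (term≤∑ (λ c → weight c χ) (lookup χ tᵢ))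
      class-count : ∀ c → W * ∑ᵛ m (weight c) ≡ size₂ (allowed c) ^ k * r ^ m
      class-count c = subst (λ k → r ^ (1 + 2 * k) * ∑ᵛ m (weight c) ≡ size₂ (allowed c) ^ k * r ^ m)
        (length-edgePositions M edges)
        (∑ᵛ-pairsHold-colourAt tᵢ c (allowed c) _ (unique-edgePositions M edges unique))

^-rebalance : ∀ x {a b c d} → a + b ≡ c + d → x ^ a * x ^ b ≡ x ^ c * x ^ d
^-rebalance x {a} {b} {c} {d} a+b≡c+d =
  trans (sym (^-distribˡ-+-* x a b)) (trans (cong (x ^_) a+b≡c+d) (^-distribˡ-+-* x c d))

cube>square : ∀ s → (3 * (8 + s) ∸ 2) ^ 2 < (8 + s) ^ 3
cube>square s = subst (1 + (3 * (8 + s) ∸ 2) ^ 2 ≤_) (sym (expand s)) (m≤m+n _ _)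
  where
  -- The base on the right is the normal form of 3 * (8 + x) ∸ 2, i.e. 22 + 3x.
  expand : ∀ x → (8 + x) * ((8 + x) * ((8 + x) * 1))
               ≡ 1 + (6 + (x + ((8 + x) + ((8 + x) + 0)))) * ((6 + (x + ((8 + x) + ((8 + x) + 0)))) * 1)
                   + (27 + 60 * x + 15 * (x * x) + x * x * x)
  expand = solve-∀

<-of-scaled-bound : ∀ {G W P Z T B} .{{_ : NonZero Z}} → G * W ≤ P * Z → P < T → T * Z ≡ B * W → G < B
<-of-scaled-bound {G} {W} {P} {Z} {T} {B} GW≤PZ P<T TZ≡BW = *-cancelʳ-< W G B (begin-strict
  G * W ≤⟨ GW≤PZ ⟩
  P * Z <⟨ *-monoˡ-< Z P<T ⟩
  T * Z ≡⟨ TZ≡BW ⟩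
  B * W ∎)
  where open ≤-Reasoning

module _ {r Q : ℕ} .{{_ : NonZero r}} (Q²<r³ : Q ^ 2 < r ^ 3) where

  ^-2*<^-3* : ∀ e .{{_ : NonZero e}} → Q ^ (2 * e) < r ^ (3 * e)
  ^-2*<^-3* e = subst₂ _<_ (^-*-assoc Q 2 e) (^-*-assoc r 3 e) (^-monoˡ-< e Q²<r³)

  <-of-even-bound : ∀ {G N e} .{{_ : NonZero e}} →
    G * r ^ (1 + 2 * (2 * e)) ≤ r * (Q ^ (2 * e) * r ^ (N + suc e)) → G < r ^ (N + 1)
  <-of-even-bound {G} {N} {e} bound =
    <-of-scaled-bound {{m^n≢0 r (suc X)}}
      (subst (G * r ^ (1 + 2 * (2 * e)) ≤_) (x∙yz≈y∙xz r (Q ^ (2 * e)) _) bound) (^-2*<^-3* e)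
      (^-rebalance r {3 * e} {suc X} {N + 1} exponents)
    where
    X = N + suc e
    exponents : 3 * e + suc X ≡ (N + 1) + (1 + 2 * (2 * e))
    exponents = identity N e
      where
      identity : ∀ N e → 3 * e + suc (N + suc e) ≡ (N + 1) + (1 + 2 * (2 * e))
      identity = solve-∀

  <-of-odd-bound : ∀ {G N e} .{{_ : NonZero e}} {{Q≢0 : NonZero Q}} →
    G * r ^ (1 + 2 * (2 * e + 1)) ≤ r * (Q ^ (2 * e + 1) * r ^ (N + suc e)) → r * G < r ^ N * Q
  <-of-odd-bound {G} {N} {e} {{_}} {{Q≢0}} bound =
    <-of-scaled-bound {{m*n≢0 Q (r ^ suc X) {{Q≢0}} {{m^n≢0 r (suc X)}}}}
      (subst₂ _≤_ (sym (xy∙z≈y∙xz r G _)) rearranged bound) (^-2*<^-3* e) powers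
    where
    open ≡-Reasoning
    X = N + suc e
    rearranged : r * (Q ^ (2 * e + 1) * r ^ X) ≡ Q ^ (2 * e) * (Q * r ^ suc X)
    rearranged = begin
      r * (Q ^ (2 * e + 1) * r ^ X)     ≡⟨ cong (λ q → r * (q * r ^ X)) (^-distribˡ-+-* Q (2 * e) 1) ⟩
      r * (Q ^ (2 * e) * (Q * 1) * r ^ X) ≡⟨ shuffle r Q (Q ^ (2 * e)) (r ^ X) ⟩
      Q ^ (2 * e) * (Q * r ^ suc X)       ∎
      where
      shuffle : ∀ r Q P Y → r * (P * (Q * 1) * Y) ≡ P * (Q * (r * Y))
      shuffle = solve-∀
    exponents : 3 * e + suc X ≡ N + 2 * (2 * e + 1)
    exponents = identity N e
      where
      identity : ∀ N e → 3 * e + suc (N + suc e) ≡ N + 2 * (2 * e + 1)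
      identity = solve-∀
    powers : r ^ (3 * e) * (Q * r ^ suc X) ≡ r ^ N * Q * r ^ (2 * (2 * e + 1))
    powers = begin
      r ^ (3 * e) * (Q * r ^ suc X)       ≡⟨ x∙yz≈y∙xz (r ^ (3 * e)) Q _ ⟩
      Q * (r ^ (3 * e) * r ^ suc X)       ≡⟨ cong (Q *_) (^-rebalance r {3 * e} {suc X} {N} exponents) ⟩
      Q * (r ^ N * r ^ (2 * (2 * e + 1))) ≡⟨ x∙yz≈yx∙z Q (r ^ N) _ ⟩
      r ^ N * Q * r ^ (2 * (2 * e + 1))   ∎

mainTheorem17 : (n r c : ℕ) → 1 ≤ n → 8 ≤ r → 1 < c →
    (A : List ℕ) → SubsetOf n A → card A ≡ ⌈ n /2⌉ + c →
    ((∃[ t ] (t ∈ A × kAtLeast t A (2 * (c ∸ 1)))) → g A r < r ^ (⌈ n /2⌉ + 1))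
    × ((∃[ t ] (t ∈ A × kAtLeast t A (2 * (c ∸ 1) + 1))) → r * g A r < r ^ ⌈ n /2⌉ * (3 * r ∸ 2))
mainTheorem17 n r (suc (suc d)) _ (s≤s (s≤s (s≤s (s≤s (s≤s (s≤s (s≤s (s≤s (z≤n {s}))))))))) (s≤s (s≤s _)) A _ |A| =
  fromMatching (<-of-even-bound {Q = 3 * r ∸ 2} (cube>square s) {G = g A r} {N = ⌈ n /2⌉} {e = suc d}) ,
  fromMatching (<-of-odd-bound {Q = 3 * r ∸ 2} (cube>square s) {G = g A r} {N = ⌈ n /2⌉} {e = suc d})
  where
  fromMatching : ∀ {k} {P : Set} →
    (g A r * r ^ (1 + 2 * k) ≤ r * ((3 * r ∸ 2) ^ k * r ^ (⌈ n /2⌉ + suc (suc d))) → P) →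
    ∃[ t ] (t ∈ A × kAtLeast t A k) → P
  fromMatching conclude (t , t∈A , M , (edges , unique) , |M|≡k) =
    conclude (subst₂ (λ k m → g A r * r ^ (1 + 2 * k) ≤ r * ((3 * r ∸ 2) ^ k * r ^ m)) |M|≡k |A|
                     (g-matching-bound A t∈A (s≤s (s≤s z≤n)) M edges unique))
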